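{- Let $L$ be a latin square of order $n$ and $G = \mathrm{gcs}(L)$. If $(i,j;k) \in G$ then $i \neq n-1$ and $j \neq n-1$.
   Context: Latin squares of order $n$ have rows, columns, symbols indexed by $N_n=\{0,\ldots,n-1\}$ and are identified with sets of triples $(r,c;e)$ ($e$ in cell $(r,c)$). A partial latin square $P\subseteq L$ is uniquely completable if $L$ is the only latin square of order $n$ containing $P$. The greedy critical set $\mathrm{gcs}(L)$: start with $P=L$ and process the cells in the order $(n-1,n-1),(n-1,n-2),\ldots,(n-1,0),(n-2,n-1),\ldots,(0,0)$ (rows bottom to top, each row right to left); at cell $(x,y)$ with $(x,y;z)\in P$, replace $P$ by $P\setminus\{(x,y;z)\}$ if that set is still uniquely completable, otherwise keep $P$. The final $P$ is $\mathrm{gcs}(L)$. -}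

module Defs where

open import Data.Nat using (ℕ)
open import Data.Fin using (Fin) renaming (_≟_ to _≟F_)
open import Data.Bool using (Bool; true; false; if_then_else_; _∧_)
open import Data.List using (List; []; _∷_; allFin; reverse; concatMap; map)
open import Data.Product using (_×_; _,_)
open import Function.Definitions using (Injective)
open import Relation.Binary.PropositionalEquality using (_≡_)
open import Relation.Nullary using (¬_; does)

-- A latin square of order n: an n×n array over symbols Fin n in which
-- every symbol occurs at most (hence, by finiteness, exactly) once in each
-- row and each column.  The triple (r,c;e) belongs to L iff entry L r c ≡ e.
record LatinSquare (n : ℕ) : Set where
  field
    entry  : Fin n → Fin n → Fin n
    rowInj : ∀ r → Injective _≡_ _≡_ (entry r)
    colInj : ∀ c → Injective _≡_ _≡_ (λ r → entry r c)
open LatinSquare public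

-- A partial latin square contained in a fixed latin square L is determined
-- by the set of cells it keeps: P = {(r,c; entry L r c) | P r c ≡ true}.
Cells : ℕ → Set
Cells n = Fin n → Fin n → Bool

Contains : ∀ {n} → LatinSquare n → LatinSquare n → Cells n → Set
Contains {n} L L' P = ∀ (r c : Fin n) → P r c ≡ true → entry L' r c ≡ entry L r c

UniquelyCompletable : ∀ {n} → LatinSquare n → Cells n → Set
UniquelyCompletable {n} L P =
  ∀ (L' : LatinSquare n) → Contains L L' P → ∀ (r c : Fin n) → entry L' r c ≡ entry L r c

allCells : ∀ {n} → Cells n
allCells _ _ = true

removeCell : ∀ {n} → Cells n → Fin n × Fin n → Cells n
removeCell P (x , y) r c = if does (r ≟F x) ∧ does (c ≟F y) then false else P r c

downFrom : (n : ℕ) → List (Fin n)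
downFrom n = reverse (allFin n)

greedyOrder : (n : ℕ) → List (Fin n × Fin n)
greedyOrder n = concatMap (λ x → map (λ y → (x , y)) (downFrom n)) (downFrom n)

data Greedy {n : ℕ} (L : LatinSquare n) : List (Fin n × Fin n) → Cells n → Cells n → Set where
  done   : ∀ {P} → Greedy L [] P P
  remove : ∀ {c cs P Q} → UniquelyCompletable L (removeCell P c) →
           Greedy L cs (removeCell P c) Q → Greedy L (c ∷ cs) P Q
  keep   : ∀ {c cs P Q} → ¬ UniquelyCompletable L (removeCell P c) →
           Greedy L cs P Q → Greedy L (c ∷ cs) P Q

IsGCS : ∀ {n} → LatinSquare n → Cells n → Set
IsGCS {n} L G = Greedy L (greedyOrder n) allCells G

{-# OPTIONS --safe #-}
module Submission where

-- In a latin square each row and each column is a permutation, so the entry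
-- of a cell is determined by the other cells of its row, and also by the
-- other cells of its column.  The greedy procedure starts at the last row,
-- right to left: when it reaches (n-1, j) the rest of column j is still
-- untouched, and when it reaches (i, n-1), the first cell of row i, the rest
-- of row i is untouched.  In both cases the cell is therefore redundant and
-- gets removed.

open import Defs
open import Data.Nat using (ℕ; _∸_; zero; suc)
open import Data.Nat.Properties using (1+n≰n)
open import Data.Fin using (Fin; toℕ; fromℕ; inject₁; punchOut; _≟_)
open import Data.Fin.Properties using (any?; punchOut-injective; injective⇒≤; toℕ-fromℕ; toℕ-injective)
open import Data.Bool using (true; false; _∧_)
open import Data.Product using (_×_; _,_; proj₁; proj₂; ∃; uncurry)
open import Data.List using (List; []; _∷_; _∷ʳ_; map; concatMap; reverse; tabulate; allFin)
open import Data.List.Properties using (reverse-++; reverse-map; map-tabulate)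
open import Data.List.Relation.Unary.All using (All; universal)
open import Data.List.Relation.Unary.All.Properties as All using ()
open import Data.List.Relation.Unary.Any as Any using ()
open import Data.List.Relation.Unary.Any.Properties using (reverse⁺)
open import Data.List.Relation.Unary.First as First using (First; [_]; _∷_)
open import Data.List.Relation.Unary.First.Properties as FirstP using (++⁺; ⁺++)
open import Data.List.Membership.Propositional using (_∈_)
open import Data.List.Membership.Propositional.Properties using (∈-allFin)
open import Function using (_∘_; id)
open import Function.Definitions using (Injective)
open import Level using (0ℓ)
open import Relation.Binary.Definitions using (DecidableEquality)
open import Relation.Binary.PropositionalEquality
  using (_≡_; _≢_; refl; sym; trans; cong; subst; module ≡-Reasoning)
open import Relation.Nullary using (¬_; yes; no; does; contradiction)
open import Relation.Unary using (Pred; _⊆_; ∁)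

injective⇒surjective : ∀ {n} {f : Fin n → Fin n} → Injective _≡_ _≡_ f → ∀ y → ∃ λ x → f x ≡ y
injective⇒surjective {suc m} {f} f-inj y with any? (λ x → f x ≟ y)
... | yes hit = hit
... | no miss = contradiction (injective⇒≤ {f = f-punched} f-punched-inj) 1+n≰n
  where
  y≢f : ∀ x → y ≢ f x
  y≢f x y≡fx = miss (x , sym y≡fx)

  f-punched : Fin (suc m) → Fin m
  f-punched x = punchOut (y≢f x)

  f-punched-inj : Injective _≡_ _≡_ f-punched
  f-punched-inj {a} {b} = f-inj ∘ punchOut-injective (y≢f a) (y≢f b)

agree-except-at⇒agree-at : ∀ {n} {f g : Fin n → Fin n} → Injective _≡_ _≡_ f → Injective _≡_ _≡_ g →
  ∀ y → (∀ x → x ≢ y → g x ≡ f x) → g y ≡ f y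
agree-except-at⇒agree-at {f = f} {g} f-inj g-inj y agree with injective⇒surjective {f = g} g-inj (f y)
... | x , gx≡fy with x ≟ y
...   | yes refl = gx≡fy
...   | no x≢y = contradiction (f-inj (trans (sym (agree x x≢y)) gx≡fy)) x≢y

Cell : ℕ → Set
Cell n = Fin n × Fin n

infix 4 _∈ᶜ_ _∉ᶜ_

_∈ᶜ_ : ∀ {n} → Cell n → Cells n → Set
u ∈ᶜ P = uncurry P u ≡ true

_∉ᶜ_ : ∀ {n} → Cell n → Cells n → Set
u ∉ᶜ P = ¬ (u ∈ᶜ P)

removeCell-removes : ∀ {n} (P : Cells n) t → t ∉ᶜ removeCell P t
removeCell-removes P (x , y) with x ≟ x | y ≟ y
... | yes _ | yes _ = λ ()
... | no x≢x | _ = contradiction refl x≢x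
... | yes _ | no y≢y = contradiction refl y≢y

removeCell-keeps : ∀ {n} (P : Cells n) (t u : Cell n) → u ≢ t → u ∈ᶜ P → u ∈ᶜ removeCell P t
removeCell-keeps P (x , y) (r , c) u≢t u∈P with r ≟ x | c ≟ y
... | yes refl | yes refl = contradiction refl u≢t
... | yes _ | no _ = u∈P
... | no _ | _ = u∈P

removeCell-⊆ : ∀ {n} (P : Cells n) t → (_∈ᶜ removeCell P t) ⊆ (_∈ᶜ P)
removeCell-⊆ P (x , y) {r , c} with does (r ≟ x) ∧ does (c ≟ y)
... | true = λ ()
... | false = id

allCells-uniquelyCompletable : ∀ {n} (L : LatinSquare n) → UniquelyCompletable L allCells
allCells-uniquelyCompletable L L' L'⊇L r c = L'⊇L r c refl

removeCell-uniquelyCompletable : ∀ {n} (L : LatinSquare n) P x y → UniquelyCompletable L P →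
  (∀ L' → Contains L L' (removeCell P (x , y)) → entry L' x y ≡ entry L x y) →
  UniquelyCompletable L (removeCell P (x , y))
removeCell-uniquelyCompletable L P x y P-uc forced L' L'⊇P₋ = P-uc L' L'⊇P
  where
  L'⊇P : Contains L L' P
  L'⊇P r c rc∈P with r ≟ x | c ≟ y
  ... | yes refl | yes refl = forced L' L'⊇P₋
  ... | no r≢x | _ = L'⊇P₋ r c (removeCell-keeps P (x , y) (r , c) (r≢x ∘ cong proj₁) rc∈P)
  ... | _ | no c≢y = L'⊇P₋ r c (removeCell-keeps P (x , y) (r , c) (c≢y ∘ cong proj₂) rc∈P)

ForcedBy : ∀ {n} → LatinSquare n → Pred (Cell n) 0ℓ → Cell n → Set
ForcedBy {n} L S t = ∀ (P : Cells n) → UniquelyCompletable L P → S ⊆ (_∈ᶜ P) →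
  UniquelyCompletable L (removeCell P t)

rowExcept : ∀ {n} → Fin n → Fin n → Pred (Cell n) 0ℓ
rowExcept x y (r , c) = r ≡ x × c ≢ y

colExcept : ∀ {n} → Fin n → Fin n → Pred (Cell n) 0ℓ
colExcept x y (r , c) = c ≡ y × r ≢ x

rowExcept-forces : ∀ {n} (L : LatinSquare n) x y → ForcedBy L (rowExcept x y) (x , y)
rowExcept-forces L x y P P-uc row⊆P = removeCell-uniquelyCompletable L P x y P-uc λ L' L'⊇P₋ →
  agree-except-at⇒agree-at (rowInj L x) (rowInj L' x) y λ c c≢y →
    L'⊇P₋ x c (removeCell-keeps P (x , y) (x , c) (c≢y ∘ cong proj₂) (row⊆P (refl , c≢y)))

colExcept-forces : ∀ {n} (L : LatinSquare n) x y → ForcedBy L (colExcept x y) (x , y)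
colExcept-forces L x y P P-uc col⊆P = removeCell-uniquelyCompletable L P x y P-uc λ L' L'⊇P₋ →
  agree-except-at⇒agree-at (colInj L y) (colInj L' y) x λ r r≢x →
    L'⊇P₋ r y (removeCell-keeps P (x , y) (r , y) (r≢x ∘ cong proj₁) (col⊆P (refl , r≢x)))

Greedy-⊆ : ∀ {n} {L : LatinSquare n} {cs P Q} → Greedy L cs P Q → (_∈ᶜ Q) ⊆ (_∈ᶜ P)
Greedy-⊆ done = id
Greedy-⊆ {P = P} (remove {c = t} _ greedy) = removeCell-⊆ P t ∘ Greedy-⊆ greedy
Greedy-⊆ (keep _ greedy) = Greedy-⊆ greedy

-- The invariants along the way: the current set is uniquely completable
-- and still contains S, since no cell of S is processed before t.
Greedy-removes-forced : ∀ {n} {L : LatinSquare n} {cs P Q} {S t} → Greedy L cs P Q →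
  UniquelyCompletable L P → S ⊆ (_∈ᶜ P) → ForcedBy L S t → First (∁ S) (_≡ t) cs → t ∉ᶜ Q
Greedy-removes-forced {P = P} {t = t} (remove _ greedy) _ _ _ [ refl ] =
  removeCell-removes P t ∘ Greedy-⊆ greedy
Greedy-removes-forced (keep ¬uc _) P-uc S⊆P forced [ refl ] = contradiction (forced _ P-uc S⊆P) ¬uc
Greedy-removes-forced {P = P} {S = S} (remove {c = c} uc greedy) _ S⊆P forced (c∉S ∷ later) =
  Greedy-removes-forced greedy uc S⊆P₋ forced later
  where
  S⊆P₋ : S ⊆ (_∈ᶜ removeCell P c)
  S⊆P₋ {u} s = removeCell-keeps P c u (λ { refl → c∉S s }) (S⊆P s)
Greedy-removes-forced (keep _ greedy) P-uc S⊆P forced (_ ∷ later) =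
  Greedy-removes-forced greedy P-uc S⊆P forced later

First-concatMap⁺ : ∀ {A B : Set} {P Q : Pred B 0ℓ} {f : A → List B} {xs} →
  First (All P ∘ f) (First P Q ∘ f) xs → First P Q (concatMap f xs)
First-concatMap⁺ [ q ] = ⁺++ q _
First-concatMap⁺ (ps ∷ later) = ++⁺ ps (First-concatMap⁺ later)

∈⇒First : ∀ {A : Set} → DecidableEquality A → ∀ {x : A} {xs} → x ∈ xs → First (x ≢_) (x ≡_) xs
∈⇒First _≟ᴬ_ {x} {y ∷ ys} x∈ with x ≟ᴬ y
... | yes x≡y = [ x≡y ]
... | no x≢y = x≢y ∷ ∈⇒First _≟ᴬ_ (Any.tail x≢y x∈)

tabulate-∷ʳ : ∀ {A : Set} m (f : Fin (suc m) → A) →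
  tabulate f ≡ tabulate (f ∘ inject₁) ∷ʳ f (fromℕ m)
tabulate-∷ʳ zero f = refl
tabulate-∷ʳ (suc m) f = cong (f Fin.zero ∷_) (tabulate-∷ʳ m (f ∘ Fin.suc))

downFrom-suc : ∀ m → downFrom (suc m) ≡ fromℕ m ∷ map inject₁ (downFrom m)
downFrom-suc m = begin
  reverse (tabulate id)                        ≡⟨ cong reverse (tabulate-∷ʳ m id) ⟩
  reverse (tabulate inject₁ ∷ʳ fromℕ m)       ≡⟨ reverse-++ (tabulate inject₁) (fromℕ m ∷ []) ⟩
  fromℕ m ∷ reverse (tabulate inject₁)        ≡⟨ cong (λ xs → fromℕ m ∷ reverse xs) (map-tabulate id inject₁) ⟨
  fromℕ m ∷ reverse (map inject₁ (allFin m))  ≡⟨ cong (fromℕ m ∷_) (reverse-map inject₁ (allFin m)) ⟨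
  fromℕ m ∷ map inject₁ (downFrom m)          ∎
  where open ≡-Reasoning

∈-downFrom : ∀ {n} (i : Fin n) → i ∈ downFrom n
∈-downFrom i = reverse⁺ (∈-allFin i)

First-downFrom-fromℕ : ∀ {m} {P Q : Pred (Fin (suc m)) 0ℓ} → Q (fromℕ m) → First P Q (downFrom (suc m))
First-downFrom-fromℕ q = subst (First _ _) (sym (downFrom-suc _)) [ q ]

rowCells : ∀ {n} → Fin n → List (Cell n)
rowCells {n} x = map (x ,_) (downFrom n)

module _ {m} {L : LatinSquare (suc m)} {G : Cells (suc m)} (gcs : IsGCS L G) where

  lastRow-∉ : ∀ j → (fromℕ m , j) ∉ᶜ G
  lastRow-∉ j = Greedy-removes-forced gcs (allCells-uniquelyCompletable L) (λ _ → refl)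
    (colExcept-forces L (fromℕ m) j)
    (First-concatMap⁺ {f = rowCells} (First-downFrom-fromℕ (FirstP.map⁺
      (First.map (λ _ (_ , last≢last) → last≢last refl) (cong (fromℕ m ,_) ∘ sym)
        (∈⇒First _≟_ (∈-downFrom j))))))

  lastCol-∉ : ∀ i → (i , fromℕ m) ∉ᶜ G
  lastCol-∉ i = Greedy-removes-forced gcs (allCells-uniquelyCompletable L) (λ _ → refl)
    (rowExcept-forces L i (fromℕ m))
    (First-concatMap⁺ {f = rowCells} (First.map
      (λ i≢x → All.map⁺ (universal (λ _ (x≡i , _) → i≢x (sym x≡i)) _))
      (λ { refl → FirstP.map⁺ (First-downFrom-fromℕ refl) })
      (∈⇒First _≟_ (∈-downFrom i))))

toℕ≡⇒≡fromℕ : ∀ {m} {i : Fin (suc m)} → toℕ i ≡ m → i ≡ fromℕ m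
toℕ≡⇒≡fromℕ {m} toℕi≡m = toℕ-injective (trans toℕi≡m (sym (toℕ-fromℕ m)))

corollary3p5 : ∀ (n : ℕ) (L : LatinSquare n) (G : Cells n) → IsGCS L G →
    ∀ (i j : Fin n) → G i j ≡ true → (toℕ i ≢ n ∸ 1) × (toℕ j ≢ n ∸ 1)
corollary3p5 zero L G gcs () j
corollary3p5 (suc m) L G gcs i j ij∈G =
  (λ toℕi≡m → lastRow-∉ gcs j (subst (λ x → (x , j) ∈ᶜ G) (toℕ≡⇒≡fromℕ toℕi≡m) ij∈G)) ,
  (λ toℕj≡m → lastCol-∉ gcs i (subst (λ y → (i , y) ∈ᶜ G) (toℕ≡⇒≡fromℕ toℕj≡m) ij∈G))
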